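{- Let $k\ge 1$ be an integer and $G$ a finite simple graph, and let $G+K_1$ denote the graph obtained from $G$ by adding one new isolated vertex. Then $G$ is a $k$-color-line graph if and only if $G+K_1$ is a $(k+1)$-color-line graph; and $G$ is a proper $k$-color-line graph if and only if $G+K_1$ is a proper $(k+1)$-color-line graph.
   Context: An edge $k$-coloring of a graph $H$ is a map $\phi:E(H)\to\{1,\dots,k\}$; it is proper if any two distinct edges sharing an endvertex get different colors. For an edge-colored graph $(H,\phi)$, the color-line graph $\mathrm{CL}(H)$ has vertex set $E(H)$, two distinct vertices being adjacent iff the corresponding edges of $H$ share an endvertex or have the same color. $G$ is a (proper) $k$-color-line graph if $G\cong\mathrm{CL}(H)$ for some graph $H$ with a (proper) edge $k$-coloring. -}

module Defs where

open import Data.Nat using (ℕ; suc)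
open import Data.Fin using (Fin; zero; suc)
open import Data.Product using (Σ; _×_; _,_; proj₁; proj₂)
open import Data.Sum using (_⊎_; inj₁; inj₂)
open import Data.Empty using (⊥)
open import Relation.Nullary using (¬_)
open import Relation.Binary.PropositionalEquality using (_≡_; refl) renaming (sym to ≡-sym)
open import Function.Bundles using (_⤖_; Bijection; _⇔_)

record Graph (n : ℕ) : Set₁ where
  field
    Adj   : Fin n → Fin n → Set
    sym   : ∀ {x y} → Adj x y → Adj y x
    irrefl : ∀ {x} → ¬ Adj x x
open Graph public

_≅_ : ∀ {n m} → Graph n → Graph m → Set
_≅_ {n} {m} G H =
  Σ (Fin n ⤖ Fin m) λ f →
    ∀ x y → Adj G x y ⇔ Adj H (Bijection.to f x) (Bijection.to f y)

record EdgeGraph : Set where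
  field
    m   : ℕ
    e   : ℕ
    end : Fin e → Fin m × Fin m
    loopless : ∀ i → ¬ (proj₁ (end i) ≡ proj₂ (end i))
    simple : ∀ i j →
      ((proj₁ (end i) ≡ proj₁ (end j)) × (proj₂ (end i) ≡ proj₂ (end j))) ⊎
      ((proj₁ (end i) ≡ proj₂ (end j)) × (proj₂ (end i) ≡ proj₁ (end j))) →
      i ≡ j
open EdgeGraph public

IsEnd : (H : EdgeGraph) → Fin (e H) → Fin (m H) → Set
IsEnd H i v = (v ≡ proj₁ (end H i)) ⊎ (v ≡ proj₂ (end H i))

ShareEnd : (H : EdgeGraph) → Fin (e H) → Fin (e H) → Set
ShareEnd H i j = Σ (Fin (m H)) λ v → IsEnd H i v × IsEnd H j v

EdgeColoring : EdgeGraph → ℕ → Set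
EdgeColoring H k = Fin (e H) → Fin k

Proper : (H : EdgeGraph) {k : ℕ} → EdgeColoring H k → Set
Proper H φ = ∀ i j → ¬ (i ≡ j) → ShareEnd H i j → ¬ (φ i ≡ φ j)

CL : (H : EdgeGraph) {k : ℕ} → EdgeColoring H k → Graph (e H)
CL H φ = record
  { Adj = λ i j → ¬ (i ≡ j) × (ShareEnd H i j ⊎ (φ i ≡ φ j))
  ; sym = CL-sym
  ; irrefl = λ { (ne , _) → ne refl }
  }
  where
  CL-sym : ∀ {i j} → ¬ (i ≡ j) × (ShareEnd H i j ⊎ (φ i ≡ φ j)) →
                      ¬ (j ≡ i) × (ShareEnd H j i ⊎ (φ j ≡ φ i))
  CL-sym (ne , inj₁ (v , a , b)) = (λ q → ne (≡-sym q)) , inj₁ (v , b , a)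
  CL-sym (ne , inj₂ q) = (λ r → ne (≡-sym r)) , inj₂ (≡-sym q)

IsColorLine : ∀ {n} → ℕ → Graph n → Set
IsColorLine k G = Σ EdgeGraph λ H → Σ (EdgeColoring H k) λ φ → G ≅ CL H φ

IsProperColorLine : ∀ {n} → ℕ → Graph n → Set
IsProperColorLine k G =
  Σ EdgeGraph λ H → Σ (EdgeColoring H k) λ φ → Proper H φ × (G ≅ CL H φ)

-- G + K₁ : add a new isolated vertex (the vertex zero; old vertices shifted by suc)
AddAdj : ∀ {n} → Graph n → Fin (suc n) → Fin (suc n) → Set
AddAdj G zero _ = ⊥
AddAdj G (suc x) zero = ⊥
AddAdj G (suc x) (suc y) = Adj G x y

plusK1 : ∀ {n} → Graph n → Graph (suc n)
plusK1 {n} G = record { Adj = AddAdj G ; sym = λ {x} {y} → s {x} {y} ; irrefl = λ {x} → ir {x} }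
  where
  s : ∀ {x y} → AddAdj G x y → AddAdj G y x
  s {zero} {_} ()
  s {suc x} {zero} ()
  s {suc x} {suc y} a = Graph.sym G a
  ir : ∀ {x} → ¬ AddAdj G x x
  ir {zero} ()
  ir {suc x} a = irrefl G a

-- Adding a disjoint edge with a fresh colour to H adds an isolated vertex to CL(H), and
-- keeps the colouring proper. Conversely, the edge of H' representing the isolated vertex
-- of CL(H') ≅ G + K₁ shares its colour with no other edge, so deleting it and removing
-- that colour from the palette (punchOut) leaves a k-colouring whose colour-line graph is G.

module Submission where

open import Defs
open import Data.Nat using (ℕ; suc; _≥_)
open import Data.Fin using (Fin; zero; suc; fromℕ; inject₁; punchOut)
open import Data.Fin.Properties
  using (suc-injective; fromℕ≢inject₁; inject₁-injective; punchOut-cong; punchOut-injective)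
open import Data.Product using (_×_; _,_; proj₁; proj₂; swap)
import Data.Product as Product
import Data.Sum as Sum
open import Data.Sum using (inj₁; inj₂)
open import Function using (_∘_; id)
open import Function.Bundles using (_⇔_; _⤖_; Bijection; mk⤖; mk⇔; Equivalence)
open import Function.Definitions using (Injective)
open import Function.Construct.Composition using (_⤖-∘_; _⇔-∘_)
open import Function.Construct.Identity using (⤖-id; ⇔-id)
open import Function.Construct.Symmetry using (⇔-sym)
open import Relation.Nullary using (¬_)
open import Relation.Binary.PropositionalEquality
  using (_≡_; _≢_; refl; cong) renaming (sym to ≡-sym)

≅-trans : ∀ {n₁ n₂ n₃} {G₁ : Graph n₁} {G₂ : Graph n₂} {G₃ : Graph n₃} →
          G₁ ≅ G₂ → G₂ ≅ G₃ → G₁ ≅ G₃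
≅-trans (f , f-adj) (g , g-adj) =
  g ⤖-∘ f , λ x y → g-adj (Bijection.to f x) (Bijection.to f y) ⇔-∘ f-adj x y

liftFin⤖ : ∀ {n m} → Fin n ⤖ Fin m → Fin (suc n) ⤖ Fin (suc m)
liftFin⤖ {n} {m} f = mk⤖ {to = lift} (lift-injective , lift-surjective)
  where
  lift : Fin (suc n) → Fin (suc m)
  lift zero    = zero
  lift (suc x) = suc (Bijection.to f x)

  lift-injective : Injective _≡_ _≡_ lift
  lift-injective {zero}  {zero}  _ = refl
  lift-injective {suc x} {suc y} p = cong suc (Bijection.injective f (suc-injective p))

  lift-surjective : ∀ y → Product.∃ λ x → ∀ {z} → z ≡ x → lift z ≡ y
  lift-surjective zero = zero , λ { refl → refl }
  lift-surjective (suc y) with Bijection.surjective f y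
  ... | x , fx≡y = suc x , λ { refl → cong suc (fx≡y refl) }

plusK1-cong : ∀ {n m} {G : Graph n} {H : Graph m} → G ≅ H → plusK1 G ≅ plusK1 H
plusK1-cong {G = G} {H} (f , f-adj) = liftFin⤖ f , adj
  where
  adj : ∀ x y → Adj (plusK1 G) x y ⇔ Adj (plusK1 H) (Bijection.to (liftFin⤖ f) x)
                                                     (Bijection.to (liftFin⤖ f) y)
  adj zero    _       = mk⇔ (λ ()) (λ ())
  adj (suc x) zero    = mk⇔ (λ ()) (λ ())
  adj (suc x) (suc y) = f-adj x y

CL-Adj-reindex : ∀ {k k'} (H H' : EdgeGraph) (φ : EdgeColoring H k) (φ' : EdgeColoring H' k')
  (r : Fin (e H) → Fin (e H')) → Injective _≡_ _≡_ r →
  (∀ i j → ShareEnd H i j ⇔ ShareEnd H' (r i) (r j)) →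
  (∀ i j → φ i ≡ φ j ⇔ φ' (r i) ≡ φ' (r j)) →
  ∀ i j → Adj (CL H φ) i j ⇔ Adj (CL H' φ') (r i) (r j)
CL-Adj-reindex H H' φ φ' r r-injective share colour i j = mk⇔
  (Product.map (_∘ r-injective) (Sum.map (to (share i j)) (to (colour i j))))
  (Product.map (_∘ cong r) (Sum.map (from (share i j)) (from (colour i j))))
  where open Equivalence

Proper-reindex : ∀ {k k'} (H H' : EdgeGraph) {φ : EdgeColoring H k} {φ' : EdgeColoring H' k'}
  (r : Fin (e H) → Fin (e H')) → Injective _≡_ _≡_ r →
  (∀ i j → ShareEnd H i j → ShareEnd H' (r i) (r j)) →
  (∀ i j → φ i ≡ φ j → φ' (r i) ≡ φ' (r j)) →
  Proper H' φ' → Proper H φ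
Proper-reindex H H' r r-injective share colour proper i j i≢j s =
  proper (r i) (r j) (i≢j ∘ r-injective) (share i j s) ∘ colour i j

addDisjointEdge : EdgeGraph → EdgeGraph
addDisjointEdge H = record
  { m = suc (suc (m H)) ; e = suc (e H) ; end = end′ ; loopless = loopless′ ; simple = simple′ }
  where
  end′ : Fin (suc (e H)) → Fin (suc (suc (m H))) × Fin (suc (suc (m H)))
  end′ zero    = zero , suc zero
  end′ (suc i) = suc (suc (proj₁ (end H i))) , suc (suc (proj₂ (end H i)))

  suc-suc-injective : ∀ {a b : Fin (m H)} →
                      _≡_ {A = Fin (suc (suc (m H)))} (suc (suc a)) (suc (suc b)) → a ≡ b
  suc-suc-injective = suc-injective ∘ suc-injective

  loopless′ : ∀ i → ¬ (proj₁ (end′ i) ≡ proj₂ (end′ i))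
  loopless′ zero    ()
  loopless′ (suc i) = loopless H i ∘ suc-suc-injective

  simple′ : ∀ i j →
    ((proj₁ (end′ i) ≡ proj₁ (end′ j)) × (proj₂ (end′ i) ≡ proj₂ (end′ j))) Sum.⊎
    ((proj₁ (end′ i) ≡ proj₂ (end′ j)) × (proj₂ (end′ i) ≡ proj₁ (end′ j))) → i ≡ j
  simple′ zero    zero    _             = refl
  simple′ zero    (suc j) (inj₁ (() , _))
  simple′ zero    (suc j) (inj₂ (() , _))
  simple′ (suc i) zero    (inj₁ (() , _))
  simple′ (suc i) zero    (inj₂ (() , _))
  simple′ (suc i) (suc j) p =
    cong suc (simple H i j (Sum.map (Product.map suc-suc-injective suc-suc-injective)
                                    (Product.map suc-suc-injective suc-suc-injective) p))

module _ (H : EdgeGraph) where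

  freshColour : ∀ {k} → EdgeColoring H k → EdgeColoring (addDisjointEdge H) (suc k)
  freshColour φ zero    = fromℕ _
  freshColour φ (suc i) = inject₁ (φ i)

  private
    IsEnd-old : ∀ i v → IsEnd (addDisjointEdge H) (suc i) v →
                Product.∃ λ w → (v ≡ suc (suc w)) × IsEnd H i w
    IsEnd-old i v (inj₁ p) = _ , p , inj₁ refl
    IsEnd-old i v (inj₂ p) = _ , p , inj₂ refl

  ShareEnd-addDisjointEdge : ∀ i j → ShareEnd H i j ⇔ ShareEnd (addDisjointEdge H) (suc i) (suc j)
  ShareEnd-addDisjointEdge i j = mk⇔ to from
    where
    lift : ∀ {l w} → IsEnd H l w → IsEnd (addDisjointEdge H) (suc l) (suc (suc w))
    lift (inj₁ refl) = inj₁ refl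
    lift (inj₂ refl) = inj₂ refl

    to : ShareEnd H i j → ShareEnd (addDisjointEdge H) (suc i) (suc j)
    to (w , i∋w , j∋w) = suc (suc w) , lift i∋w , lift j∋w

    from : ShareEnd (addDisjointEdge H) (suc i) (suc j) → ShareEnd H i j
    from (v , i∋v , j∋v) with IsEnd-old i v i∋v | IsEnd-old j v j∋v
    ... | w , refl , i∋w | _ , v≡w′ , j∋w′ with suc-injective (suc-injective v≡w′)
    ... | refl = w , i∋w , j∋w′

  new-¬ShareEnd : ∀ j → ¬ ShareEnd (addDisjointEdge H) zero (suc j)
  new-¬ShareEnd j (v , new∋v , j∋v) with IsEnd-old j v j∋v
  new-¬ShareEnd j (_ , inj₁ () , _) | _ , refl , _
  new-¬ShareEnd j (_ , inj₂ () , _) | _ , refl , _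

  module _ {k} (φ : EdgeColoring H k) where

    plusK1-≅-CL-addDisjointEdge : ∀ {n} {G : Graph n} → G ≅ CL H φ →
                                  plusK1 G ≅ CL (addDisjointEdge H) (freshColour φ)
    plusK1-≅-CL-addDisjointEdge {G = G} iso =
      ≅-trans {G₁ = plusK1 G} {plusK1 (CL H φ)} {CL (addDisjointEdge H) (freshColour φ)}
              (plusK1-cong {G = G} {CL H φ} iso) (⤖-id _ , adj)
      where
      adj : ∀ i j → Adj (plusK1 (CL H φ)) i j ⇔ Adj (CL (addDisjointEdge H) (freshColour φ)) i j
      adj zero    zero    = mk⇔ (λ ()) (λ (i≢i , _) → i≢i refl)
      adj zero    (suc j) = mk⇔ (λ ()) λ { (_ , inj₁ s) → new-¬ShareEnd j s
                                         ; (_ , inj₂ c) → fromℕ≢inject₁ c }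
      adj (suc i) zero    = mk⇔ (λ ()) λ { (_ , inj₁ s) → new-¬ShareEnd i (Product.map₂ swap s)
                                         ; (_ , inj₂ c) → fromℕ≢inject₁ (≡-sym c) }
      adj (suc i) (suc j) = CL-Adj-reindex H (addDisjointEdge H) φ (freshColour φ) suc suc-injective
        ShareEnd-addDisjointEdge (λ i j → mk⇔ (cong inject₁) inject₁-injective) i j

    freshColour-proper : Proper H φ → Proper (addDisjointEdge H) (freshColour φ)
    freshColour-proper proper zero    zero    i≢i _ _ = i≢i refl
    freshColour-proper proper zero    (suc j) _   s _ = new-¬ShareEnd j s
    freshColour-proper proper (suc i) zero    _   s _ = new-¬ShareEnd i (Product.map₂ swap s)
    freshColour-proper proper (suc i) (suc j) i≢j s =
      proper i j (i≢j ∘ cong suc) (Equivalence.from (ShareEnd-addDisjointEdge i j) s)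
      ∘ inject₁-injective

restrictEdges : (H : EdgeGraph) {n : ℕ} (ι : Fin n → Fin (e H)) → Injective _≡_ _≡_ ι → EdgeGraph
restrictEdges H {n} ι ι-injective = record
  { m = m H ; e = n ; end = end H ∘ ι ; loopless = loopless H ∘ ι
  ; simple = λ i j → ι-injective ∘ simple H (ι i) (ι j) }

module RemoveNewEdge {k n} {G : Graph n} (H : EdgeGraph) (φ : EdgeColoring H (suc k))
                     (iso : plusK1 G ≅ CL H φ) where

  open Bijection (proj₁ iso) using (to; injective)

  oldEdge : Fin n → Fin (e H)
  oldEdge = to ∘ suc

  oldEdge-injective : Injective _≡_ _≡_ oldEdge
  oldEdge-injective = suc-injective ∘ injective

  H⁻ : EdgeGraph
  H⁻ = restrictEdges H oldEdge oldEdge-injective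

  newColour-fresh : ∀ x → φ (to zero) ≢ φ (oldEdge x)
  newColour-fresh x c = Equivalence.from (proj₂ iso zero (suc x)) (zero≢suc ∘ injective , inj₂ c)
    where
    zero≢suc : zero ≢ suc x
    zero≢suc ()

  φ⁻ : EdgeColoring H⁻ k
  φ⁻ x = punchOut (newColour-fresh x)

  φ⁻-≡⇔ : ∀ x y → φ⁻ x ≡ φ⁻ y ⇔ φ (oldEdge x) ≡ φ (oldEdge y)
  φ⁻-≡⇔ x y = mk⇔ (punchOut-injective (newColour-fresh x) (newColour-fresh y))
                  (punchOut-cong (φ (to zero)))

  G≅CL : G ≅ CL H⁻ φ⁻
  G≅CL = ⤖-id _ , λ x y →
    ⇔-sym (CL-Adj-reindex H⁻ H φ⁻ φ oldEdge oldEdge-injective (λ _ _ → ⇔-id _) φ⁻-≡⇔ x y)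
    ⇔-∘ proj₂ iso (suc x) (suc y)

  φ⁻-proper : Proper H φ → Proper H⁻ φ⁻
  φ⁻-proper = Proper-reindex H⁻ H oldEdge oldEdge-injective (λ _ _ → id)
                             (λ x y → Equivalence.to (φ⁻-≡⇔ x y))

mainTheorem6 : (k : ℕ) → k ≥ 1 → (n : ℕ) → (G : Graph n) →
    (IsColorLine k G ⇔ IsColorLine (suc k) (plusK1 G)) ×
    (IsProperColorLine k G ⇔ IsProperColorLine (suc k) (plusK1 G))
mainTheorem6 k _ n G =
  mk⇔ (λ (H , φ , iso) →
         addDisjointEdge H , freshColour H φ , plusK1-≅-CL-addDisjointEdge H φ iso)
      (λ (H , φ , iso) → let open RemoveNewEdge H φ iso in H⁻ , φ⁻ , G≅CL) ,
  mk⇔ (λ (H , φ , proper , iso) →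
         addDisjointEdge H , freshColour H φ , freshColour-proper H φ proper ,
         plusK1-≅-CL-addDisjointEdge H φ iso)
      (λ (H , φ , proper , iso) →
         let open RemoveNewEdge H φ iso in H⁻ , φ⁻ , φ⁻-proper proper , G≅CL)
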